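{- Let $G=(V,E)$ be a strongly connected directed graph and $P=(p_1,\dots,p_\ell)$ a cut path in $G$ with at least one inner node. If the last inner node $p_{\ell-1}$ of $P$ is a split, then the induced subgraph $G[R^+(P)]$ is strongly connected. If the first inner node $p_2$ of $P$ is a join, then $G[R^-(P)]$ is strongly connected.
   Context: A walk is a sequence of nodes with consecutive pairs being arcs; inner nodes of $(p_1,\dots,p_\ell)$ are $p_2,\dots,p_{\ell-1}$. A subwalk is a contiguous subsequence. A walk $P$ is a cut path if there exist nodes $u,v$ such that every $u$-$v$ walk in $G$ has $P$ as a subwalk. A split is a node with at least two outgoing arcs; a join is a node with at least two incoming arcs. $R^+(P)$ is the set of nodes $v$ such that there is a $p_1$-$v$ walk in $G$ with arc $(p_{\ell-1},p_\ell)$ removed; $R^-(P)$ is the set of nodes $v$ such that there is a $v$-$p_\ell$ walk in $G$ with arc $(p_1,p_2)$ removed. $G[U]$ is the subgraph induced by $U$. -}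

module Defs where

open import Data.Nat using (ℕ)
open import Data.Fin using (Fin)
open import Data.List using (List; []; _∷_; _++_)
open import Data.Product using (Σ; ∃; _×_)
open import Relation.Binary.PropositionalEquality using (_≡_; _≢_)
open import Relation.Nullary using (¬_)

Graph : ℕ → Set₁
Graph n = Fin n → Fin n → Set

module _ {n : ℕ} where

  data WalkFrom (E : Graph n) : Fin n → Fin n → List (Fin n) → Set where
    single : ∀ x → WalkFrom E x x (x ∷ [])
    step   : ∀ {x y z ws} → E x y → WalkFrom E y z ws → WalkFrom E x z (x ∷ ws)

  IsWalk : Graph n → List (Fin n) → Set
  IsWalk E ws = ∃ λ u → ∃ λ v → WalkFrom E u v ws

  Subwalk : List (Fin n) → List (Fin n) → Set
  Subwalk P W = ∃ λ as → ∃ λ bs → W ≡ as ++ P ++ bs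

  CutPath : Graph n → List (Fin n) → Set
  CutPath E P = IsWalk E P × ∃ λ u → ∃ λ v → ∀ ws → WalkFrom E u v ws → Subwalk P ws

  StronglyConnected : Graph n → Set
  StronglyConnected E = ∀ u v → ∃ λ ws → WalkFrom E u v ws

  Split : Graph n → Fin n → Set
  Split E x = ∃ λ a → ∃ λ b → a ≢ b × E x a × E x b

  Join : Graph n → Fin n → Set
  Join E x = ∃ λ a → ∃ λ b → a ≢ b × E a x × E b x

  RemoveArc : Graph n → Fin n → Fin n → Graph n
  RemoveArc E a b x y = E x y × ¬ (x ≡ a × y ≡ b)

  Induced : Graph n → (Fin n → Set) → Graph n
  Induced E U x y = E x y × U x × U y

  StronglyConnectedOn : Graph n → (Fin n → Set) → Set
  StronglyConnectedOn E U = ∀ u v → U u → U v → ∃ λ ws → WalkFrom (Induced E U) u v ws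

  -- R⁺(P) for P with first node p₁ and last arc (q , pₗ):
  -- nodes v reachable from p₁ in G minus the arc (q , pₗ)
  Rplus : Graph n → Fin n → Fin n → Fin n → (Fin n → Set)
  Rplus E p₁ q pₗ v = ∃ λ ws → WalkFrom (RemoveArc E q pₗ) p₁ v ws

  -- R⁻(P) for P with first arc (p₁ , p₂) and last node pₗ:
  -- nodes v reaching pₗ in G minus the arc (p₁ , p₂)
  Rminus : Graph n → Fin n → Fin n → Fin n → (Fin n → Set)
  Rminus E p₁ p₂ pₗ v = ∃ λ ws → WalkFrom (RemoveArc E p₁ p₂) v pₗ ws

-- Let G' be G without the last arc (q , pₗ) of P, so that R⁺(P) is the set of nodes reachable
-- from p₁ in G'. It suffices that every x ∈ R⁺(P) reaches p₁ back in G'. A G-walk from x to p₁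
-- either already avoids (q , pₗ) or shows that x reaches q in G'; in the latter case, as q is a
-- split, it has an out-neighbour c ≠ pₗ, and c reaches p₁ or q in G'. Only the last possibility
-- is critical: it gives a G'-cycle through q, and if that cycle missed p₁, winding around it long
-- enough would yield a u-v walk (for the nodes u, v witnessing the cut) that never traverses P.
-- The statement about R⁻(P) is the statement about R⁺ for the reversed graph and reversed path.
module Submission where

open import Defs
open import Data.Nat using (ℕ; zero; suc; _≤_; _<_; z≤n; s≤s)
open import Data.Nat.Properties using (≤-trans; +-mono-≤)
open import Data.Nat.Induction using (<-wellFounded)
open import Induction.WellFounded using (Acc; acc)
open import Data.Fin using (Fin)
open import Data.Fin.Properties using (_≟_)
open import Data.List using (List; []; _∷_; _++_; length; reverse)
open import Data.List.Properties
  using (++-assoc; length-++; length-++-≤ʳ; reverse-++; reverse-involutive; unfold-reverse;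
         ∷-injective; ∷-injectiveˡ; ∷-injectiveʳ)
open import Data.List.Membership.Propositional using (_∈_; _∉_)
open import Data.List.Membership.Propositional.Properties using (∈-++⁺ʳ; ∈-++⁻)
import Data.List.Membership.DecPropositional as DecMembership
open import Data.List.Relation.Unary.Any using (here; there)
open import Data.Product using (∃; ∃₂; _×_; _,_; proj₁; proj₂; map₁; map₂; swap)
open import Data.Sum using (_⊎_; inj₁; inj₂; [_,_])
import Data.Sum as Sum
open import Data.Empty using (⊥; ⊥-elim)
open import Function using (flip; _∘_)
open import Relation.Nullary using (yes; no)
open import Relation.Binary.Core using (_⇒_)
open import Relation.Binary.PropositionalEquality
  using (_≡_; refl; sym; trans; cong; subst; module ≡-Reasoning)

module _ {A : Set} where

  ++-split : ∀ xs {ys zs ws : List A} → xs ++ ys ≡ zs ++ ws →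
             (∃ λ k → zs ≡ xs ++ k × ys ≡ k ++ ws) ⊎
             (∃₂ λ z k → xs ≡ zs ++ z ∷ k × ws ≡ z ∷ k ++ ys)
  ++-split []       {zs = zs}     eq = inj₁ (zs , refl , eq)
  ++-split (x ∷ xs) {zs = []}     eq = inj₂ (x , xs , refl , sym eq)
  ++-split (x ∷ xs) {zs = z ∷ zs} eq with refl , eq′ ← ∷-injective eq with ++-split xs eq′
  ... | inj₁ (k , zs≡ , ys≡)         = inj₁ (k , cong (x ∷_) zs≡ , ys≡)
  ... | inj₂ (z′ , k , xs≡ , ws≡)    = inj₂ (z′ , k , cong (x ∷_) xs≡ , ws≡)

  ++-prefix : ∀ xs {ys zs ws : List A} → xs ++ ys ≡ zs ++ ws → length xs ≤ length zs →
              ∃ λ r → zs ≡ xs ++ r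
  ++-prefix []       {zs = zs}     _  _         = zs , refl
  ++-prefix (x ∷ xs) {zs = z ∷ zs} eq (s≤s len) with refl , eq′ ← ∷-injective eq =
    map₂ (cong (x ∷_)) (++-prefix xs eq′ len)

  split-at-unique : ∀ {x : A} xs {ys} zs {ws} → x ∉ xs → x ∉ ys →
                    xs ++ x ∷ ys ≡ zs ++ x ∷ ws → ws ≡ ys
  split-at-unique []       []       _   _   eq = sym (∷-injectiveʳ eq)
  split-at-unique (a ∷ xs) []       x∉a∷xs _ eq =
    ⊥-elim (x∉a∷xs (here (sym (∷-injectiveˡ eq))))
  split-at-unique []       (c ∷ zs) _   x∉ys eq =
    ⊥-elim (x∉ys (subst (_ ∈_) (sym (∷-injectiveʳ eq)) (∈-++⁺ʳ zs (here refl))))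
  split-at-unique (a ∷ xs) (c ∷ zs) x∉a∷xs x∉ys eq =
    split-at-unique xs zs (x∉a∷xs ∘ there) x∉ys (∷-injectiveʳ eq)

module _ {n : ℕ} where

  open DecMembership (_≟_ {n}) using (_∈?_)

  Reach : Graph n → Fin n → Fin n → Set
  Reach E s t = ∃ λ ws → WalkFrom E s t ws

  private variable
    E F : Graph n

  walk-map : ∀ {s t W} → E ⇒ F → WalkFrom E s t W → WalkFrom F s t W
  walk-map f (single x) = single x
  walk-map f (step e w) = step (f e) (walk-map f w)

  walk-join : ∀ {s m t X Z} → WalkFrom E s m X → WalkFrom E m t (m ∷ Z) → WalkFrom E s t (X ++ Z)
  walk-join (single _) w′ = w′
  walk-join (step e w) w′ = step e (walk-join w w′)

  walk-split : ∀ X {y Y s t W} → WalkFrom E s t W → W ≡ X ++ y ∷ Y →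
               WalkFrom E s y (X ++ y ∷ []) × WalkFrom E y t (y ∷ Y)
  walk-split []          (single x) refl = single x , single x
  walk-split []          (step e w) refl = single _ , step e w
  walk-split (_ ∷ [])    (single _) ()
  walk-split (_ ∷ _ ∷ _) (single _) ()
  walk-split (_ ∷ X)     (step e w) refl = map₁ (step e) (walk-split X w refl)

  walk-uncons : ∀ {s y t Y} → WalkFrom E s t (s ∷ y ∷ Y) → E s y × WalkFrom E y t (y ∷ Y)
  walk-uncons (step e w@(single _)) = e , w
  walk-uncons (step e w@(step _ _)) = e , w

  reach-step : ∀ {x y t} → E x y → Reach E y t → Reach E x t
  reach-step e (_ , w) = _ , step e w

  reach-trans : ∀ {s m t} → Reach E s m → Reach E m t → Reach E s t
  reach-trans (_ , single _) r = r
  reach-trans (_ , step e w) r = reach-step e (reach-trans (_ , w) r)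

  reach-∈ : ∀ {s t z W} → WalkFrom E s t W → z ∈ W → Reach E s z
  reach-∈ (single x) (here refl) = _ , single x
  reach-∈ (step e w) (here refl) = _ , single _
  reach-∈ (step e w) (there z∈) = reach-step e (reach-∈ w z∈)

  source-∈ : ∀ {s t W} → WalkFrom E s t W → s ∈ W
  source-∈ (single _) = here refl
  source-∈ (step _ _) = here refl

  first-visit : ∀ {s t W} → WalkFrom E s t W → ∃ λ A → t ∉ A × WalkFrom E s t (A ++ t ∷ [])
  first-visit (single _) = [] , (λ ()) , single _
  first-visit {t = t} (step {x = x} e w) with x ≟ t
  ... | yes refl = [] , (λ ()) , single _
  ... | no x≢t with A , t∉A , w′ ← first-visit w =
    x ∷ A , (λ { (here t≡x) → x≢t (sym t≡x) ; (there t∈A) → t∉A t∈A }) , step e w′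

  last-visit : ∀ {x s t W} → WalkFrom E s t W → x ∈ W →
               ∃ λ M → x ∉ M × WalkFrom E x t (x ∷ M)
  last-visit (single _) (here refl) = [] , (λ ()) , single _
  last-visit {x = x} (step {ws = ws} e w) x∈ with x ∈? ws | x∈
  ... | yes x∈ws | _          = last-visit w x∈ws
  ... | no x∉ws  | here refl  = ws , x∉ws , step e w
  ... | no x∉ws  | there x∈ws = ⊥-elim (x∉ws x∈ws)

  walk-nonempty : ∀ {s t W} → WalkFrom E s t W → 1 ≤ length W
  walk-nonempty (single _) = s≤s z≤n
  walk-nonempty (step _ _) = s≤s z≤n

  winding : ∀ {p x c W} → E x c → WalkFrom E c x W → p ∉ W →
            ∀ k → ∃ λ Z → k ≤ length Z × p ∉ Z × WalkFrom E x x (x ∷ Z)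
  winding e w p∉W zero = [] , z≤n , (λ ()) , single _
  winding {W = W} e w p∉W (suc k) with Z , k≤ , p∉Z , wZ ← winding e w p∉W k =
    W ++ Z ,
    subst (suc k ≤_) (sym (length-++ W)) (+-mono-≤ (walk-nonempty w) k≤) ,
    [ p∉W , p∉Z ] ∘ ∈-++⁻ W ,
    walk-join (step e w) wZ

  reach-without-arc : ∀ {a b s t W} → WalkFrom E s t W →
                      Reach (RemoveArc E a b) s t ⊎ Reach (RemoveArc E a b) s a
  reach-without-arc (single x) = inj₁ (_ , single x)
  reach-without-arc {a = a} {b = b} (step {x = x} {y = y} e w) with x ≟ a | y ≟ b
  ... | yes refl | yes refl = inj₂ (_ , single a)
  ... | yes refl | no y≢b   = Sum.map (reach-step e′) (reach-step e′) (reach-without-arc w)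
    where e′ = (e , y≢b ∘ proj₂)
  ... | no x≢a   | _        = Sum.map (reach-step e′) (reach-step e′) (reach-without-arc w)
    where e′ = (e , x≢a ∘ proj₁)

  split-avoiding : ∀ {E : Graph n} {x b} → Split E x → ∃ λ c → RemoveArc E x b x c
  split-avoiding {b = b} (c₁ , c₂ , c₁≢c₂ , e₁ , e₂) with c₁ ≟ b
  ... | yes refl = c₂ , e₂ , λ (_ , c₂≡c₁) → c₁≢c₂ (sym c₂≡c₁)
  ... | no c₁≢b  = c₁ , e₁ , c₁≢b ∘ proj₂

  stronglyConnectedOn-cong : ∀ {U V : Fin n → Set} →
                             (∀ {x} → U x → V x) → (∀ {x} → V x → U x) →
                             StronglyConnectedOn E U → StronglyConnectedOn E V
  stronglyConnectedOn-cong U⇒V V⇒U sc u v u∈ v∈ =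
    _ , walk-map (map₂ λ (x∈ , y∈) → U⇒V x∈ , U⇒V y∈)
                 (proj₂ (sc u v (V⇒U u∈) (V⇒U v∈)))

  stronglyConnectedOn-reach : ∀ {E F : Graph n} {r} → F ⇒ E →
                              (∀ {x} → Reach F r x → Reach F x r) →
                              StronglyConnectedOn E (Reach F r)
  stronglyConnectedOn-reach {E} {F} {r} F⇒E return s t r⇝s r⇝t
    with _ , w ← reach-trans (return r⇝s) r⇝t =
    _ , induced r⇝s w
    where
    induced : ∀ {x y W} → Reach F r x → WalkFrom F x y W → WalkFrom (Induced E (Reach F r)) x y W
    induced r⇝x (single x) = single x
    induced r⇝x (step e w) = step (F⇒E e , r⇝x , r⇝y) (induced r⇝y w)
      where r⇝y = reach-trans r⇝x (_ , step e (single _))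

  walk-reverse : ∀ {s t W} → WalkFrom E s t W → WalkFrom (flip E) t s (reverse W)
  walk-reverse (single x) = single x
  walk-reverse {E = E} (step {x = x} {ws = ws} e w) =
    subst (WalkFrom (flip E) _ _) (sym (unfold-reverse x ws)) (walk-join (walk-reverse w) (step e (single _)))

  stronglyConnected-flip : StronglyConnected E → StronglyConnected (flip E)
  stronglyConnected-flip sc u v = _ , walk-reverse (proj₂ (sc v u))

  stronglyConnectedOn-flip : ∀ {U} → StronglyConnectedOn (flip E) U → StronglyConnectedOn E U
  stronglyConnectedOn-flip sc u v u∈ v∈ =
    _ , walk-map (map₂ swap) (walk-reverse (proj₂ (sc v u v∈ u∈)))

  cutPath-flip : ∀ {P} → CutPath E P → CutPath (flip E) (reverse P)
  cutPath-flip {P = P} ((s , t , w) , u , v , cut) = (t , s , walk-reverse w) , v , u , cut′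
    where
    cut′ : ∀ ws → WalkFrom (flip _) v u ws → Subwalk (reverse P) ws
    cut′ ws w′ with as , bs , eq ← cut (reverse ws) (walk-reverse w′) =
      reverse bs , reverse as , (begin
      ws                                      ≡⟨ sym (reverse-involutive ws) ⟩
      reverse (reverse ws)                    ≡⟨ cong reverse eq ⟩
      reverse (as ++ P ++ bs)                 ≡⟨ reverse-++ as (P ++ bs) ⟩
      reverse (P ++ bs) ++ reverse as         ≡⟨ cong (_++ reverse as) (reverse-++ P bs) ⟩
      (reverse bs ++ reverse P) ++ reverse as ≡⟨ ++-assoc (reverse bs) _ _ ⟩
      reverse bs ++ reverse P ++ reverse as   ∎)
      where open ≡-Reasoning

module CutPathDetour {n : ℕ} {P : List (Fin n)} {p₁ q pₗ : Fin n} {xs ys : List (Fin n)}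
                     (P≡p₁∷ : P ≡ p₁ ∷ xs) (P≡∷qpₗ : P ≡ ys ++ q ∷ pₗ ∷ []) where

  open DecMembership (_≟_ {n}) using (_∈?_)

  occurrence-end : ∀ as bs → as ++ P ++ bs ≡ (as ++ ys) ++ q ∷ pₗ ∷ bs
  occurrence-end as bs = begin
    as ++ P ++ bs                    ≡⟨ cong (λ Q → as ++ Q ++ bs) P≡∷qpₗ ⟩
    as ++ (ys ++ q ∷ pₗ ∷ []) ++ bs   ≡⟨ cong (as ++_) (++-assoc ys _ bs) ⟩
    as ++ ys ++ q ∷ pₗ ∷ bs           ≡⟨ sym (++-assoc as ys _) ⟩
    (as ++ ys) ++ q ∷ pₗ ∷ bs         ∎
    where open ≡-Reasoning

  occurrence-split : ∀ {F : Graph n} {s t W} as bs → WalkFrom F s t W → W ≡ as ++ P ++ bs →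
                     WalkFrom F s p₁ (as ++ p₁ ∷ []) × F q pₗ × WalkFrom F pₗ t (pₗ ∷ bs)
  occurrence-split as bs w eq =
    proj₁ (walk-split as w (trans eq (cong (λ Q → as ++ Q ++ bs) P≡p₁∷))) ,
    walk-uncons (proj₂ (walk-split (as ++ ys) w (trans eq (occurrence-end as bs))))

  occurrence-shortens : ∀ {W} as bs → W ≡ as ++ P ++ bs → length (pₗ ∷ bs) < length W
  occurrence-shortens as bs eq =
    subst (λ W → length (pₗ ∷ bs) < length W) (sym (trans eq (occurrence-end as bs)))
          (length-++-≤ʳ (q ∷ pₗ ∷ bs) {as ++ ys})

  -- The u-v walk  A ++ p₁ ∷ T ++ pₗ ∷ D  must contain P. An occurrence starting at the only p₁ before
  -- D would, T being long, lie inside the G'-walk p₁ ∷ T, which lacks the last arc of P; an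
  -- occurrence inside D yields a shorter pₗ-v walk D, so well-founded recursion on D concludes.
  no-long-detour : ∀ {E : Graph n} {u v} →
                   (∀ ws → WalkFrom E u v ws → Subwalk P ws) → Reach E u v →
                   ∀ {T} → WalkFrom (RemoveArc E q pₗ) p₁ q (p₁ ∷ T) → p₁ ∉ T →
                   length P ≤ length (p₁ ∷ T) → ⊥
  no-long-detour {E} {u} {v} cut (W , w) {T} wT p₁∉T long
    with as , bs , W≡ ← cut W w
    with wA , qpₗ , wD ← occurrence-split as bs w W≡
    with A , p₁∉A , wA′ ← first-visit wA
    = avoid (<-wellFounded _) wD
    where
    detour : ∀ {D} → WalkFrom E pₗ v (pₗ ∷ D) → WalkFrom E u v ((A ++ p₁ ∷ T) ++ pₗ ∷ D)
    detour {D} wD′ =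
      subst (WalkFrom E u v) reassoc (walk-join wA′ (walk-join (walk-map proj₁ wT) (step qpₗ wD′)))
      where
      reassoc : (A ++ p₁ ∷ []) ++ T ++ pₗ ∷ D ≡ (A ++ p₁ ∷ T) ++ pₗ ∷ D
      reassoc = trans (++-assoc A (p₁ ∷ []) _) (sym (++-assoc A (p₁ ∷ T) _))

    starts-at-detour : ∀ {cs ds D k} →
                       A ++ p₁ ∷ T ≡ cs ++ p₁ ∷ k → P ++ ds ≡ p₁ ∷ k ++ pₗ ∷ D → ⊥
    starts-at-detour {cs = cs} eqA eqP with refl ← split-at-unique A cs p₁∉A p₁∉T eqA
      with r , p₁∷T≡ ← ++-prefix P eqP long
      with _ , (_ , not-removed) , _ ← occurrence-split [] r wT p₁∷T≡ =
      not-removed (refl , refl)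

    avoid : ∀ {D} → Acc _<_ (length (pₗ ∷ D)) → WalkFrom E pₗ v (pₗ ∷ D) → ⊥
    avoid (acc shorter) wD′
      with cs , ds , eq ← cut _ (detour wD′)
      with ++-split (A ++ p₁ ∷ T) {zs = cs} eq
    ... | inj₁ (k , _ , pₗ∷D≡) =
      avoid (shorter (occurrence-shortens k ds pₗ∷D≡))
            (proj₂ (proj₂ (occurrence-split k ds wD′ pₗ∷D≡)))
    ... | inj₂ (z , k , eqA , eqP)
      with refl ← ∷-injectiveˡ (trans (cong (_++ ds) (sym P≡p₁∷)) eqP) =
      starts-at-detour eqA eqP

  returns-to-head : ∀ {E : Graph n} → StronglyConnected E → CutPath E P → Split E q →
                    ∀ {x} → Reach (RemoveArc E q pₗ) p₁ x → Reach (RemoveArc E q pₗ) x p₁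
  returns-to-head {E} sc (_ , u , v , cut) split {x} p₁⇝x with reach-without-arc (proj₂ (sc x p₁))
  ... | inj₁ x⇝p₁ = x⇝p₁
  ... | inj₂ x⇝q with c , qc ← split-avoiding {E = E} split with reach-without-arc (proj₂ (sc c p₁))
  ...   | inj₁ c⇝p₁ = reach-trans x⇝q (reach-step qc c⇝p₁)
  ...   | inj₂ (W , c⇝q) with p₁ ∈? W
  ...     | yes p₁∈W = reach-trans x⇝q (reach-step qc (reach-∈ c⇝q p₁∈W))
  ...     | no p₁∉W
    with _ , p₁⇝q ← reach-trans p₁⇝x x⇝q
    with M , p₁∉M , wM ← last-visit p₁⇝q (source-∈ p₁⇝q)
    with Z , |P|≤|Z| , p₁∉Z , wZ ← winding qc c⇝q p₁∉W (length P) =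
    ⊥-elim (no-long-detour cut (sc u v) (walk-join wM wZ) ([ p₁∉M , p₁∉Z ] ∘ ∈-++⁻ M)
                           (≤-trans |P|≤|Z| (length-++-≤ʳ Z {p₁ ∷ M})))

rplus-stronglyConnectedOn : ∀ {n} {E : Graph n} {P p₁ q pₗ xs ys} →
                            StronglyConnected E → CutPath E P →
                            P ≡ p₁ ∷ xs → P ≡ ys ++ q ∷ pₗ ∷ [] →
                            Split E q → StronglyConnectedOn E (Rplus E p₁ q pₗ)
rplus-stronglyConnectedOn sc cutP P≡p₁∷ P≡∷qpₗ split =
  stronglyConnectedOn-reach proj₁ (CutPathDetour.returns-to-head P≡p₁∷ P≡∷qpₗ sc cutP split)

-- The removed arcs (p₁ , p₂) of E and (p₂ , p₁) of flip E differ only in the order of the pair.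
rminus-as-rplus-flip : ∀ {n} {E : Graph n} {p₁ p₂ pₗ x} →
                       Rminus E p₁ p₂ pₗ x → Rplus (flip E) pₗ p₂ p₁ x
rminus-as-rplus-flip (_ , w) = _ , walk-map (map₂ (_∘ swap)) (walk-reverse w)

rplus-flip-as-rminus : ∀ {n} {E : Graph n} {p₁ p₂ pₗ x} →
                       Rplus (flip E) pₗ p₂ p₁ x → Rminus E p₁ p₂ pₗ x
rplus-flip-as-rminus (_ , w) = _ , walk-map (map₂ (_∘ swap)) (walk-reverse w)

rminus-stronglyConnectedOn : ∀ {n} {E : Graph n} {P p₁ p₂ q pₗ xs ys} →
                             StronglyConnected E → CutPath E P →
                             P ≡ p₁ ∷ p₂ ∷ xs → P ≡ ys ++ q ∷ pₗ ∷ [] →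
                             Join E p₂ → StronglyConnectedOn E (Rminus E p₁ p₂ pₗ)
rminus-stronglyConnectedOn {p₁ = p₁} {p₂} {xs = xs} {ys} sc cutP P≡p₁p₂∷ P≡∷qpₗ join =
  stronglyConnectedOn-flip
    (stronglyConnectedOn-cong rplus-flip-as-rminus rminus-as-rplus-flip
      (rplus-stronglyConnectedOn (stronglyConnected-flip sc) (cutPath-flip cutP)
        (trans (cong reverse P≡∷qpₗ) (reverse-++ ys _))
        (trans (cong reverse P≡p₁p₂∷) (reverse-++ (p₁ ∷ p₂ ∷ []) xs))
        join))

lemma12 : ∀ {n : ℕ} (E : Graph n) (P : List (Fin n)) (p₁ p₂ q pₗ : Fin n)
          → StronglyConnected E
          → CutPath E P
          → 3 ≤ length P
          → (∃ λ xs → P ≡ p₁ ∷ p₂ ∷ xs)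
          → (∃ λ ys → P ≡ ys ++ q ∷ pₗ ∷ [])
          → (Split E q → StronglyConnectedOn E (Rplus E p₁ q pₗ))
            × (Join E p₂ → StronglyConnectedOn E (Rminus E p₁ p₂ pₗ))
lemma12 E P p₁ p₂ q pₗ sc cutP _ (_ , P≡p₁p₂∷) (_ , P≡∷qpₗ) =
  rplus-stronglyConnectedOn sc cutP P≡p₁p₂∷ P≡∷qpₗ ,
  rminus-stronglyConnectedOn sc cutP P≡p₁p₂∷ P≡∷qpₗ
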